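{- In any run of the gluttonous algorithm on a Steiner forest instance, if the supernodes $S,T$ are merged at an earlier iteration than the supernodes $S',T'$, then the merging distance of the merge of $S,T$ is at most the merging distance of the merge of $S',T'$.
   Context: A Steiner forest instance $(\mathcal{M},\mathcal{D})$: a finite metric space $\mathcal{M}=(V,d)$ and a set $\mathcal{D}$ of pairwise disjoint pairs $\{u,\bar u\}\subseteq V$ (terminals; $\bar u$ is the mate of $u$). A clustering is a partition of the terminals into supernodes. For a clustering $\mathcal{C}$, $G_{\mathcal{C}}$ is the complete graph on $V$ where edge $\{x,y\}$ has length $0$ if $x,y$ are terminals in a common supernode and $d(x,y)$ otherwise; $d_{\mathcal{M}/\mathcal{C}}$ is shortest-path distance in $G_{\mathcal{C}}$, and $d_{\mathcal{M}/\mathcal{C}}(S_1,S_2)=\min_{u\in S_1,v\in S_2}d_{\mathcal{M}/\mathcal{C}}(u,v)$. A terminal is active if its mate is not in its supernode; a supernode is active if it contains an active terminal. Gluttonous algorithm: start from the clustering into singletons and $E'=\emptyset$; while some supernode is active, pick two distinct active supernodes $S_1,S_2$ minimizing $d_{\mathcal{M}/\mathcal{C}}(S_1,S_2)$ (ties broken consistently), add to $E'$ the inter-supernode edges of a shortest $S_1$–$S_2$ path in $G_{\mathcal{C}}$, and replace $S_1,S_2$ by $S_1\cup S_2$ (the merge); the merging distance of this merge is $d_{\mathcal{M}/\mathcal{C}}(S_1,S_2)$ for the clustering $\mathcal{C}$ just before it. Output a maximal acyclic subgraph of $E'$. -}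

module Defs where

open import Level using (Level; 0ℓ)
open import Data.Nat using (ℕ; zero; suc; _<_)
open import Data.Fin using (Fin; _≟_)
open import Data.Maybe using (Maybe; just; nothing)
open import Data.Product using (Σ; ∃; ∃-syntax; _×_; _,_)
open import Data.Sum using (_⊎_)
open import Data.Empty using (⊥)
open import Relation.Nullary using (¬_; yes; no)
open import Relation.Binary.PropositionalEquality using (_≡_)

-- The paper uses real-valued metrics; the standard library has no reals.
-- We therefore work over an arbitrary totally ordered commutative monoid
-- (of which (ℝ, 0, +, ≤) is an instance).

record DistDomain : Set₁ where
  infixl 6 _+_
  infix  4 _≤_
  field
    Carrier  : Set
    0#       : Carrier
    _+_      : Carrier → Carrier → Carrier
    _≤_      : Carrier → Carrier → Set
    ≤-refl   : ∀ {x} → x ≤ x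
    ≤-trans  : ∀ {x y z} → x ≤ y → y ≤ z → x ≤ z
    ≤-antisym : ∀ {x y} → x ≤ y → y ≤ x → x ≡ y
    ≤-total  : ∀ x y → x ≤ y ⊎ y ≤ x
    +-assoc  : ∀ x y z → (x + y) + z ≡ x + (y + z)
    +-comm   : ∀ x y → x + y ≡ y + x
    +-identityˡ : ∀ x → 0# + x ≡ x
    +-monoˡ-≤ : ∀ {x y} z → x ≤ y → x + z ≤ y + z

record IsMetric (K : DistDomain) (n : ℕ) (d : Fin n → Fin n → DistDomain.Carrier K) : Set where
  open DistDomain K
  field
    nonneg   : ∀ x y → 0# ≤ d x y
    zero-iff : ∀ x y → d x y ≡ 0# → x ≡ y
    self     : ∀ x → d x x ≡ 0#
    sym      : ∀ x y → d x y ≡ d y x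
    triangle : ∀ x y z → d x z ≤ d x y + d y z

-- Demand pairs: a partial "mate" function.  mate u ≡ just v means {u,v}
-- is a demand pair.

record IsDemands (n : ℕ) (mate : Fin n → Maybe (Fin n)) : Set where
  field
    mate-sym  : ∀ u v → mate u ≡ just v → mate v ≡ just u
    mate-irr  : ∀ u → ¬ (mate u ≡ just u)

module Gluttonous (K : DistDomain) {n : ℕ}
                  (d : Fin n → Fin n → DistDomain.Carrier K)
                  (mate : Fin n → Maybe (Fin n)) where
  open DistDomain K

  Terminal : Fin n → Set
  Terminal u = ∃[ v ] mate u ≡ just v

  -- A clustering is represented by a labelling of points by supernode
  -- names; the supernode named a consists of the terminals u with
  -- label u ≡ a (labels of non-terminals are irrelevant).
  Clustering : Set
  Clustering = Fin n → Fin n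

  singletons : Clustering
  singletons x = x

  InSuper : Clustering → Fin n → Fin n → Set
  InSuper C a u = Terminal u × C u ≡ a

  IsSuper : Clustering → Fin n → Set
  IsSuper C a = ∃[ u ] InSuper C a u

  ActiveTerminal : Clustering → Fin n → Set
  ActiveTerminal C u = ∃[ v ] (mate u ≡ just v × ¬ (C v ≡ C u))

  ActiveSuper : Clustering → Fin n → Set
  ActiveSuper C a = ∃[ u ] (InSuper C a u × ActiveTerminal C u)

  SameSuper : Clustering → Fin n → Fin n → Set
  SameSuper C x y = Terminal x × Terminal y × C x ≡ C y

  data EdgeLen (C : Clustering) (x y : Fin n) : Carrier → Set where
    contracted : SameSuper C x y → EdgeLen C x y 0#
    original   : ¬ SameSuper C x y → EdgeLen C x y (d x y)

  data WalkLen (C : Clustering) : Fin n → Fin n → Carrier → Set where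
    here : ∀ {x} → WalkLen C x x 0#
    step : ∀ {x y z ℓ₁ ℓ₂} → EdgeLen C x y ℓ₁ → WalkLen C y z ℓ₂ →
           WalkLen C x z (ℓ₁ + ℓ₂)

  SuperDist : Clustering → Fin n → Fin n → Carrier → Set
  SuperDist C a b D =
    (∃[ u ] ∃[ v ] (InSuper C a u × InSuper C b v × WalkLen C u v D)) ×
    (∀ u v ℓ → InSuper C a u → InSuper C b v → WalkLen C u v ℓ → D ≤ ℓ)

  merge : Clustering → Fin n → Fin n → Clustering
  merge C a b x with C x ≟ b
  ... | yes _ = a
  ... | no  _ = C x

  clusterAt : (ℕ → Fin n × Fin n) → ℕ → Clustering
  clusterAt ch zero = singletons
  clusterAt ch (suc i) with ch i
  ... | (a , b) = merge (clusterAt ch i) a b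

  GluttonousStep : Clustering → Fin n → Fin n → Carrier → Set
  GluttonousStep C a b D =
    ActiveSuper C a × ActiveSuper C b × ¬ (a ≡ b) × SuperDist C a b D ×
    (∀ a' b' D' → ActiveSuper C a' → ActiveSuper C b' → ¬ (a' ≡ b') →
       SuperDist C a' b' D' → D ≤ D')

  NoActive : Clustering → Set
  NoActive C = ∀ a → ¬ ActiveSuper C a

  record IsRun (m : ℕ) (ch : ℕ → Fin n × Fin n) (D : ℕ → Carrier) : Set where
    field
      steps : ∀ i → i < m →
              GluttonousStep (clusterAt ch i)
                (Data.Product.proj₁ (ch i)) (Data.Product.proj₂ (ch i)) (D i)
      done  : NoActive (clusterAt ch m)

-- Let δ be the merging distance of a gluttonous step merging S_a and S_b in
-- the clustering C, so that every walk in G_C between terminals of two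
-- distinct active supernodes has length at least δ.  Take a walk in the next
-- graph G_{C'} between terminals of two distinct active supernodes of C';
-- these terminals lie in active supernodes of C.  The only edges that became
-- shorter are the new zero edges between the active S_a and S_b; cutting the walk at such an edge either
-- leaves a G_C-walk between distinct active supernodes of C before the cut,
-- or a shorter walk of the same kind after it.  Hence the next merging
-- distance is at least δ, and monotonicity along the run follows by
-- induction.  That d_{M/C} is attained uses finiteness: loop erasure shows
-- a shortest walk may be taken among the finitely many simple paths.
module Submission where

open import Defs
open import Level using (0ℓ)
open import Data.Nat using (ℕ; zero; suc; _<_; s≤s) renaming (_≤_ to _≤ℕ_)
import Data.Nat.Properties as ℕ
open import Data.Fin using (Fin; _≟_)
open import Data.Fin.Properties using (injective⇒≤)
open import Data.Maybe using (Maybe; just; nothing)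
open import Data.Product using (_×_; _,_; proj₁; proj₂; ∃-syntax)
open import Data.Sum using (_⊎_; inj₁; inj₂)
open import Data.Empty using (⊥-elim)
open import Data.List
  using (List; []; _∷_; length; lookup; allFin; filter; cartesianProduct; cartesianProductWith)
open import Data.List.Relation.Unary.Any using (here; there)
open import Data.List.Relation.Unary.All as All using ()
open import Data.List.Relation.Unary.All.Properties using (¬Any⇒All¬; all-filter)
open import Data.List.Relation.Unary.AllPairs using ([]; _∷_)
open import Data.List.Relation.Unary.Unique.Propositional using (Unique)
open import Data.List.Membership.Propositional using (_∈_)
open import Data.List.Membership.Propositional.Properties
  using (∈-lookup; ∈-allFin; ∈-filter⁺; ∈-cartesianProduct⁺; ∈-cartesianProductWith⁺)
open import Function.Definitions using (Injective)
open import Relation.Nullary using (Dec; yes; no)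
open import Relation.Unary using (Pred; Decidable)
open import Relation.Binary.Bundles using (TotalOrder)
open import Relation.Binary.PropositionalEquality
  using (_≡_; _≢_; refl; sym; trans; cong; cong₂; subst; subst₂; isEquivalence)

module DistDomainProperties (K : DistDomain) where
  open DistDomain K

  ≤-reflexive : ∀ {x y} → x ≡ y → x ≤ y
  ≤-reflexive refl = ≤-refl

  +-monoʳ-≤ : ∀ {x y} z → x ≤ y → z + x ≤ z + y
  +-monoʳ-≤ {x} {y} z x≤y = subst₂ _≤_ (+-comm x z) (+-comm y z) (+-monoˡ-≤ z x≤y)

  x≤y+x : ∀ {x y} → 0# ≤ y → x ≤ y + x
  x≤y+x {x} {y} 0≤y = subst (_≤ y + x) (+-identityˡ x) (+-monoˡ-≤ x 0≤y)

  x≤x+y : ∀ {x y} → 0# ≤ y → x ≤ x + y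
  x≤x+y {x} {y} 0≤y = subst (x ≤_) (+-comm y x) (x≤y+x 0≤y)

  +-nonneg : ∀ {x y} → 0# ≤ x → 0# ≤ y → 0# ≤ x + y
  +-nonneg 0≤x 0≤y = ≤-trans 0≤x (x≤x+y 0≤y)

  totalOrder : TotalOrder 0ℓ 0ℓ 0ℓ
  totalOrder = record
    { isTotalOrder = record
      { isPartialOrder = record
        { isPreorder = record
          { isEquivalence = isEquivalence ; reflexive = ≤-reflexive ; trans = ≤-trans }
        ; antisym = ≤-antisym }
      ; total = ≤-total } }

  mono-from-suc : ∀ (f : ℕ → Carrier) m → (∀ i → suc i < m → f i ≤ f (suc i)) →
                  ∀ i j → i < j → j < m → f i ≤ f j
  mono-from-suc f m f-suc i (suc j) i<1+j 1+j<m with ℕ.m<1+n⇒m<n∨m≡n i<1+j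
  ... | inj₂ refl = f-suc i 1+j<m
  ... | inj₁ i<j  = ≤-trans (mono-from-suc f m f-suc i j i<j (ℕ.<-trans (ℕ.n<1+n j) 1+j<m))
                            (f-suc j 1+j<m)

module FinLists (n : ℕ) where

  lookup-injective : ∀ {xs : List (Fin n)} → Unique xs → Injective _≡_ _≡_ (lookup xs)
  lookup-injective (_ ∷ _)     {Fin.zero}  {Fin.zero}  _  = refl
  lookup-injective (x∉ ∷ _)    {Fin.zero}  {Fin.suc j} eq = ⊥-elim (All.lookup x∉ (∈-lookup j) eq)
  lookup-injective (x∉ ∷ _)    {Fin.suc i} {Fin.zero}  eq = ⊥-elim (All.lookup x∉ (∈-lookup i) (sym eq))
  lookup-injective (_ ∷ uniq)  {Fin.suc i} {Fin.suc j} eq = cong Fin.suc (lookup-injective uniq eq)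

  Unique⇒length≤ : ∀ {xs : List (Fin n)} → Unique xs → length xs ≤ℕ n
  Unique⇒length≤ uniq = injective⇒≤ (lookup-injective uniq)

  listsUpTo : ℕ → List (List (Fin n))
  listsUpTo zero    = [] ∷ []
  listsUpTo (suc k) = [] ∷ cartesianProductWith _∷_ (allFin n) (listsUpTo k)

  ∈-listsUpTo : ∀ k (xs : List (Fin n)) → length xs ≤ℕ k → xs ∈ listsUpTo k
  ∈-listsUpTo zero    []       _         = here refl
  ∈-listsUpTo (suc k) []       _         = here refl
  ∈-listsUpTo (suc k) (x ∷ xs) (s≤s len≤) =
    there (∈-cartesianProductWith⁺ _∷_ (∈-allFin x) (∈-listsUpTo k xs len≤))

-- A path in the complete graph on Fin n with edge weights w is a start vertex
-- x together with the list xs of the vertices visited after it.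
module WeightedPaths (K : DistDomain) {n : ℕ}
                     (w : Fin n → Fin n → DistDomain.Carrier K)
                     (w-nonneg : ∀ x y → DistDomain._≤_ K (DistDomain.0# K) (w x y)) where
  open DistDomain K
  open DistDomainProperties K
  open FinLists n
  open import Data.List.Extrema totalOrder using (argmin; argmin-all; f[argmin]≤f[xs])
  open import Data.List.Membership.DecPropositional (_≟_ {n}) using (_∈?_)

  last : Fin n → List (Fin n) → Fin n
  last x []       = x
  last x (y ∷ ys) = last y ys

  weight : Fin n → List (Fin n) → Carrier
  weight x []       = 0#
  weight x (y ∷ ys) = w x y + weight y ys

  weight-nonneg : ∀ x xs → 0# ≤ weight x xs
  weight-nonneg x []       = ≤-refl
  weight-nonneg x (y ∷ ys) = +-nonneg (w-nonneg x y) (weight-nonneg y ys)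

  SimpleShortcut : Fin n → Fin n → List (Fin n) → Set
  SimpleShortcut x y ys =
    ∃[ zs ] (last x zs ≡ last y ys × weight x zs ≤ weight y ys × Unique (x ∷ zs))

  suffix-shortcut : ∀ {x} y ys → x ∈ (y ∷ ys) → Unique (y ∷ ys) → SimpleShortcut x y ys
  suffix-shortcut y ys       (here refl) uniq = ys , refl , ≤-refl , uniq
  suffix-shortcut y (z ∷ zs) (there x∈)  (_ ∷ uniq) with suffix-shortcut z zs x∈ uniq
  ... | vs , end≡ , vs≤ , uniq′ = vs , end≡ , ≤-trans vs≤ (x≤y+x (w-nonneg y z)) , uniq′

  loop-erase : ∀ x xs → SimpleShortcut x x xs
  loop-erase x []       = [] , refl , ≤-refl , All.[] ∷ []
  loop-erase x (y ∷ xs) with loop-erase y xs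
  ... | ys , end≡ , ys≤ , uniq with x ∈? (y ∷ ys)
  ...   | no x∉ = y ∷ ys , end≡ , +-monoʳ-≤ (w x y) ys≤ , ¬Any⇒All¬ (y ∷ ys) x∉ ∷ uniq
  ...   | yes x∈ with suffix-shortcut y ys x∈ uniq
  ...     | zs , end≡′ , zs≤ , uniq′ =
    zs , trans end≡′ end≡ , ≤-trans zs≤ (≤-trans ys≤ (x≤y+x (w-nonneg x y))) , uniq′

  Connects : Pred (Fin n) 0ℓ → Pred (Fin n) 0ℓ → Pred (Fin n × List (Fin n)) 0ℓ
  Connects P Q (x , xs) = P x × Q (last x xs)

  shortest-path : ∀ {P Q} → Decidable P → Decidable Q → ∀ {x xs} → Connects P Q (x , xs) →
                  ∃[ y ] ∃[ ys ] (Connects P Q (y , ys) ×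
                    ∀ x′ xs′ → Connects P Q (x′ , xs′) → weight y ys ≤ weight x′ xs′)
  shortest-path {P} {Q} P? Q? {x} {xs} connects = proj₁ best , proj₂ best , best-connects , best-min
    where
      Connects? : Decidable (Connects P Q)
      Connects? (y , ys) with P? y | Q? (last y ys)
      ... | yes p | yes q = yes (p , q)
      ... | no ¬p | _     = no λ c → ¬p (proj₁ c)
      ... | yes _ | no ¬q = no λ c → ¬q (proj₂ c)

      pathWeight : Fin n × List (Fin n) → Carrier
      pathWeight (y , ys) = weight y ys

      -- By loop erasure, simple paths suffice, and they have fewer than n edges.
      shortPaths : List (Fin n × List (Fin n))
      shortPaths = cartesianProduct (allFin n) (listsUpTo n)

      candidates : List (Fin n × List (Fin n))
      candidates = filter Connects? shortPaths

      best : Fin n × List (Fin n)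
      best = argmin pathWeight (x , xs) candidates

      best-connects : Connects P Q best
      best-connects = argmin-all pathWeight connects (all-filter Connects? shortPaths)

      best-min : ∀ x′ xs′ → Connects P Q (x′ , xs′) → pathWeight best ≤ weight x′ xs′
      best-min x′ xs′ (p , q) with loop-erase x′ xs′
      ... | ys , end≡ , ys≤ , uniq =
        ≤-trans (All.lookup (f[argmin]≤f[xs] (x , xs) candidates) ∈candidates) ys≤
        where
          ∈candidates : (x′ , ys) ∈ candidates
          ∈candidates = ∈-filter⁺ Connects?
            (∈-cartesianProduct⁺ (∈-allFin x′)
              (∈-listsUpTo n ys (ℕ.<⇒≤ (Unique⇒length≤ uniq))))
            (p , subst Q (sym end≡) q)

module GluttonousProperties (K : DistDomain) {n : ℕ}
                            (d : Fin n → Fin n → DistDomain.Carrier K)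
                            (mate : Fin n → Maybe (Fin n))
                            (d-nonneg : ∀ x y → DistDomain._≤_ K (DistDomain.0# K) (d x y)) where
  open DistDomain K
  open DistDomainProperties K
  open Gluttonous K d mate

  terminal? : Decidable Terminal
  terminal? u with mate u
  ... | just v  = yes (v , refl)
  ... | nothing = no λ { (_ , ()) }

  inSuper? : ∀ C a → Decidable (InSuper C a)
  inSuper? C a u with terminal? u | C u ≟ a
  ... | yes t | yes e = yes (t , e)
  ... | no ¬t | _     = no λ s → ¬t (proj₁ s)
  ... | yes _ | no ¬e = no λ s → ¬e (proj₂ s)

  sameSuper? : ∀ C x y → Dec (SameSuper C x y)
  sameSuper? C x y with terminal? x | terminal? y | C x ≟ C y
  ... | yes tx | yes ty | yes e = yes (tx , ty , e)
  ... | no ¬tx | _      | _     = no λ s → ¬tx (proj₁ s)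
  ... | yes _  | no ¬ty | _     = no λ s → ¬ty (proj₁ (proj₂ s))
  ... | yes _  | yes _  | no ¬e = no λ s → ¬e (proj₂ (proj₂ s))

  edgeLength : Clustering → Fin n → Fin n → Carrier
  edgeLength C x y with sameSuper? C x y
  ... | yes _ = 0#
  ... | no  _ = d x y

  edgeLength-nonneg : ∀ C x y → 0# ≤ edgeLength C x y
  edgeLength-nonneg C x y with sameSuper? C x y
  ... | yes _ = ≤-refl
  ... | no  _ = d-nonneg x y

  EdgeLen-edgeLength : ∀ C x y → EdgeLen C x y (edgeLength C x y)
  EdgeLen-edgeLength C x y with sameSuper? C x y
  ... | yes s  = contracted s
  ... | no  ¬s = original ¬s

  EdgeLen⇒≡edgeLength : ∀ {C x y ℓ} → EdgeLen C x y ℓ → ℓ ≡ edgeLength C x y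
  EdgeLen⇒≡edgeLength {C} {x} {y} (contracted s) with sameSuper? C x y
  ... | yes _  = refl
  ... | no  ¬s = ⊥-elim (¬s s)
  EdgeLen⇒≡edgeLength {C} {x} {y} (original ¬s) with sameSuper? C x y
  ... | yes s = ⊥-elim (¬s s)
  ... | no  _ = refl

  walk-nonneg : ∀ {C x y ℓ} → WalkLen C x y ℓ → 0# ≤ ℓ
  walk-nonneg             here       = ≤-refl
  walk-nonneg {C} {x} (step {y = y} e walk) =
    +-nonneg (subst (0# ≤_) (sym (EdgeLen⇒≡edgeLength e)) (edgeLength-nonneg C x y))
             (walk-nonneg walk)

  walk-snoc : ∀ {C x y z ℓ₁ ℓ₂} → WalkLen C x y ℓ₁ → EdgeLen C y z ℓ₂ → WalkLen C x z (ℓ₁ + ℓ₂)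
  walk-snoc {C} {x} {_} {z} {ℓ₂ = ℓ₂} here e = subst (WalkLen C x z) (+-comm ℓ₂ 0#) (step e here)
  walk-snoc {C} {x} {_} {z} {ℓ₂ = ℓ₂} (step {ℓ₁ = ℓ} {ℓ₂ = ℓ′} e walk) e′ =
    subst (WalkLen C x z) (sym (+-assoc ℓ ℓ′ ℓ₂)) (step e (walk-snoc walk e′))

  module _ (C : Clustering) where
    open WeightedPaths K (edgeLength C) (edgeLength-nonneg C)

    walk→path : ∀ {x z ℓ} → WalkLen C x z ℓ → ∃[ xs ] (last x xs ≡ z × weight x xs ≡ ℓ)
    walk→path here = [] , refl , refl
    walk→path (step {y = y} e walk) with walk→path walk
    ... | xs , end≡ , weight≡ = y ∷ xs , end≡ , cong₂ _+_ (sym (EdgeLen⇒≡edgeLength e)) weight≡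

    path→walk : ∀ x xs → WalkLen C x (last x xs) (weight x xs)
    path→walk x []       = here
    path→walk x (y ∷ ys) = step (EdgeLen-edgeLength C x y) (path→walk y ys)

    superDist-exists : ∀ {a b u v ℓ} → InSuper C a u → InSuper C b v → WalkLen C u v ℓ →
                       ∃[ δ ] SuperDist C a b δ
    superDist-exists {a} {b} {u} {v} u∈a v∈b walk with walk→path walk
    ... | xs , end≡ , _
      with shortest-path (inSuper? C a) (inSuper? C b) {u} {xs}
             (u∈a , subst (InSuper C b) (sym end≡) v∈b)
    ... | y , ys , (y∈a , end∈b) , minimal =
      weight y ys , (y , last y ys , y∈a , end∈b , path→walk y ys) , lower-bound
      where
        lower-bound : ∀ u′ v′ ℓ′ → InSuper C a u′ → InSuper C b v′ → WalkLen C u′ v′ ℓ′ → weight y ys ≤ ℓ′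
        lower-bound u′ v′ ℓ′ u′∈a v′∈b walk′ with walk→path walk′
        ... | xs′ , end≡′ , weight≡′ =
          ≤-trans (minimal u′ xs′ (u′∈a , subst (InSuper C b) (sym end≡′) v′∈b)) (≤-reflexive weight≡′)

  merge-cases : ∀ C a b x → (C x ≡ b × merge C a b x ≡ a) ⊎ (C x ≢ b × merge C a b x ≡ C x)
  merge-cases C a b x with C x ≟ b
  ... | yes e  = inj₁ (e , refl)
  ... | no  ¬e = inj₂ (¬e , refl)

  merge-resp : ∀ C a b {x y} → C x ≡ C y → merge C a b x ≡ merge C a b y
  merge-resp C a b {x} {y} Cx≡Cy with merge-cases C a b x | merge-cases C a b y
  ... | inj₁ (_ , p)     | inj₁ (_ , q)     = trans p (sym q)
  ... | inj₁ (Cx≡b , _)  | inj₂ (Cy≢b , _)  = ⊥-elim (Cy≢b (trans (sym Cx≡Cy) Cx≡b))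
  ... | inj₂ (Cx≢b , _)  | inj₁ (Cy≡b , _)  = ⊥-elim (Cx≢b (trans Cx≡Cy Cy≡b))
  ... | inj₂ (_ , p)     | inj₂ (_ , q)     = trans p (trans Cx≡Cy (sym q))

  merge-joins-only : ∀ C a b {x y} → merge C a b x ≡ merge C a b y → C x ≢ C y → C x ≡ a ⊎ C x ≡ b
  merge-joins-only C a b {x} {y} eq Cx≢Cy with merge-cases C a b x | merge-cases C a b y
  ... | inj₁ (Cx≡b , _) | _            = inj₂ Cx≡b
  ... | inj₂ (_ , p)    | inj₁ (_ , q) = inj₁ (trans (sym p) (trans eq q))
  ... | inj₂ (_ , p)    | inj₂ (_ , q) = ⊥-elim (Cx≢Cy (trans (sym p) (trans eq q)))

  module AfterStep (C : Clustering) (a b : Fin n) (δ : Carrier) (gstep : GluttonousStep C a b δ) where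
    C′ : Clustering
    C′ = merge C a b

    merged-active : ∀ {x} → C x ≡ a ⊎ C x ≡ b → ActiveSuper C (C x)
    merged-active (inj₁ Cx≡a) = subst (ActiveSuper C) (sym Cx≡a) (proj₁ gstep)
    merged-active (inj₂ Cx≡b) = subst (ActiveSuper C) (sym Cx≡b) (proj₁ (proj₂ gstep))

    active-merge⁻ : ∀ {a′ u} → ActiveSuper C′ a′ → C′ u ≡ a′ → ActiveSuper C (C u)
    active-merge⁻ {u = u} (t , (t-term , C′t≡a′) , (t̄ , mate-t , C′t̄≢C′t)) C′u≡a′ with C u ≟ C t
    ... | yes Cu≡Ct = subst (ActiveSuper C) (sym Cu≡Ct)
                        (t , (t-term , refl) , (t̄ , mate-t , λ eq → C′t̄≢C′t (merge-resp C a b eq)))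
    ... | no  Cu≢Ct = merged-active (merge-joins-only C a b (trans C′u≡a′ (sym C′t≡a′)) Cu≢Ct)

    walk-between-actives : ∀ {p q ℓ} → Terminal p → Terminal q →
                           ActiveSuper C (C p) → ActiveSuper C (C q) → C p ≢ C q →
                           WalkLen C p q ℓ → δ ≤ ℓ
    walk-between-actives {p} {q} tp tq p-active q-active Cp≢Cq walk
      with superDist-exists C (tp , refl) (tq , refl) walk
    ... | δ′ , dist = ≤-trans (minimal (C p) (C q) δ′ p-active q-active Cp≢Cq dist)
                              (proj₂ dist p q _ (tp , refl) (tq , refl) walk)
      where minimal = proj₂ (proj₂ (proj₂ (proj₂ gstep)))

    -- The G_C-walk from p to x is a prefix already traversed; along the
    -- G_{C′}-walk we either extend it or, at a new zero edge between S_a and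
    -- S_b, restart from the far endpoint.
    walk-after-merge : ∀ {p x v ℓ₀ ℓ} → Terminal p → Terminal v →
                       ActiveSuper C (C p) → ActiveSuper C (C v) →
                       WalkLen C p x ℓ₀ → WalkLen C′ x v ℓ → δ ≤ ℓ₀ + ℓ ⊎ C′ p ≡ C′ v
    walk-after-merge {p} {_} {v} tp tv p-active v-active prefix here with C p ≟ C v
    ... | yes Cp≡Cv = inj₂ (merge-resp C a b Cp≡Cv)
    ... | no  Cp≢Cv = inj₁ (≤-trans (walk-between-actives tp tv p-active v-active Cp≢Cv prefix)
                                    (x≤x+y ≤-refl))
    walk-after-merge {ℓ₀ = ℓ₀} tp tv p-active v-active prefix
                     (step {ℓ₁ = ℓ₁} {ℓ₂} (original ¬same′) walk)
      with walk-after-merge tp tv p-active v-active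
             (walk-snoc prefix (original λ (tx , ty , e) → ¬same′ (tx , ty , merge-resp C a b e))) walk
    ... | inj₁ δ≤ = inj₁ (subst (δ ≤_) (+-assoc ℓ₀ ℓ₁ ℓ₂) δ≤)
    ... | inj₂ glued = inj₂ glued
    walk-after-merge {p} {x} {ℓ₀ = ℓ₀} tp tv p-active v-active prefix
                     (step {y = y} {ℓ₂ = ℓ₂} (contracted (tx , ty , C′x≡C′y)) walk)
      with C x ≟ C y
    ... | yes Cx≡Cy
      with walk-after-merge tp tv p-active v-active (walk-snoc prefix (contracted (tx , ty , Cx≡Cy))) walk
    ...   | inj₁ δ≤ = inj₁ (subst (δ ≤_) (+-assoc ℓ₀ 0# ℓ₂) δ≤)
    ...   | inj₂ glued = inj₂ glued
    walk-after-merge {p} {x} tp tv p-active v-active prefix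
                     (step {y = y} (contracted (tx , ty , C′x≡C′y)) walk)
        | no Cx≢Cy with C p ≟ C x
    ... | no Cp≢Cx =
      inj₁ (≤-trans (walk-between-actives tp tx p-active x-active Cp≢Cx prefix)
                    (x≤x+y (+-nonneg ≤-refl (walk-nonneg walk))))
      where x-active = merged-active (merge-joins-only C a b C′x≡C′y Cx≢Cy)
    ... | yes Cp≡Cx with walk-after-merge ty tv y-active v-active here walk
      where y-active = merged-active (merge-joins-only C a b (sym C′x≡C′y) (λ e → Cx≢Cy (sym e)))
    ...   | inj₁ δ≤ = inj₁ (≤-trans δ≤ (x≤y+x (walk-nonneg prefix)))
    ...   | inj₂ glued = inj₂ (trans (merge-resp C a b Cp≡Cx) (trans C′x≡C′y glued))

    merging-distance-mono : ∀ {a′ b′ δ′} → GluttonousStep C′ a′ b′ δ′ → δ ≤ δ′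
    merging-distance-mono {δ′ = δ′}
      (a′-active , b′-active , a′≢b′ , ((u , v , (tu , C′u≡a′) , (tv , C′v≡b′) , walk) , _) , _)
      with walk-after-merge tu tv (active-merge⁻ a′-active C′u≡a′) (active-merge⁻ b′-active C′v≡b′)
             here walk
    ... | inj₁ δ≤ = subst (δ ≤_) (+-identityˡ δ′) δ≤
    ... | inj₂ glued = ⊥-elim (a′≢b′ (trans (sym C′u≡a′) (trans glued C′v≡b′)))

claim3p3 : (K : DistDomain) (n : ℕ) (d : Fin n → Fin n → DistDomain.Carrier K) (mate : Fin n → Maybe (Fin n)) → IsMetric K n d → IsDemands n mate → (m : ℕ) (ch : ℕ → Fin n × Fin n) (D : ℕ → DistDomain.Carrier K) → Gluttonous.IsRun K d mate m ch D → ∀ i j → i < j → j < m → DistDomain._≤_ K (D i) (D j)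
claim3p3 K n d mate metric _ m ch D run = mono-from-suc D m consecutive
  where
    open DistDomainProperties K
    open Gluttonous K d mate
    open GluttonousProperties K d mate (IsMetric.nonneg metric)

    consecutive : ∀ i → suc i < m → DistDomain._≤_ K (D i) (D (suc i))
    consecutive i 1+i<m =
      AfterStep.merging-distance-mono (clusterAt ch i) (proj₁ (ch i)) (proj₂ (ch i)) (D i)
        (IsRun.steps run i (ℕ.<-trans (ℕ.n<1+n i) 1+i<m))
        (IsRun.steps run (suc i) 1+i<m)
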